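{- Let $p,p'$ be coprime with $1\le p<p'$ and let $p'/p$ have continued fraction $[c_0,\ldots,c_n]$ with associated parameters $t_k,t,y_k,z_k,\kappa_j,\tilde\kappa_j$. Let $1<k\le n$ and $1\le r<z_k$. If $t_k<j\le t$, then $\left\lfloor \frac{p'(r+\tilde\kappa_j)}{p}\right\rfloor=\left\lfloor \frac{p'r}{p}\right\rfloor+\kappa_j.$
   Context: The continued fraction $[c_0,\ldots,c_n]$ of $p'/p$ satisfies $c_i\ge1$ for $i<n$, $c_n\ge2$, and $p'/p=c_0+1/(c_1+1/(\cdots+1/c_n))$. Set $t_k=-1+\sum_{i=0}^{k-1}c_i$ for $0\le k\le n+1$ and $t=t_{n+1}-1$. Define $y_{ -1}=0,y_0=1$, $z_{ -1}=1,z_0=0$, $y_k=c_{k-1}y_{k-1}+y_{k-2}$, $z_k=c_{k-1}z_{k-1}+z_{k-2}$ for $1\le k\le n+1$. For $0\le k\le n$ and $t_k<j\le t_{k+1}$ set $\kappa_j=y_{k-1}+(j-t_k)y_k$ and $\tilde\kappa_j=z_{k-1}+(j-t_k)z_k$. -}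

module Defs where

open import Data.Nat using (ℕ; zero; suc) renaming (_+_ to _+ℕ_; _*_ to _*ℕ_)
open import Data.Product using (_×_; _,_)
open import Data.Integer using (ℤ; +_; _+_; _-_; _*_; _/_)

-- The continued fraction is given by a sequence c : ℕ → ℕ, of which only
-- c 0, ..., c n are used.

-- cfFrom c i m : the fraction [c_i, c_{i+1}, ..., c_{i+m}] evaluated
-- (unreduced) as a pair (numerator , denominator):
--   [c_i] = c_i / 1,   [c_i, rest] = c_i + 1/[rest] = (c_i*a + b)/a  if [rest] = a/b.
cfFrom : (ℕ → ℕ) → ℕ → ℕ → ℕ × ℕ
cfFrom c i zero = c i , 1
cfFrom c i (suc m) with cfFrom c (suc i) m
... | a , b = c i *ℕ a +ℕ b , a

cfNum : (ℕ → ℕ) → ℕ → ℕ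
cfNum c n with cfFrom c 0 n
... | a , _ = a

cfDen : (ℕ → ℕ) → ℕ → ℕ
cfDen c n with cfFrom c 0 n
... | _ , b = b

S : (ℕ → ℕ) → ℕ → ℕ
S c zero = 0
S c (suc k) = S c k +ℕ c k

tk : (ℕ → ℕ) → ℕ → ℤ
tk c k = + S c k - + 1

tt : (ℕ → ℕ) → ℕ → ℤ
tt c n = tk c (suc n) - + 1

-- Shifted indexing: Y m = y_{m-1}, Z m = z_{m-1}  (so Y 0 = y_{-1}, Y 1 = y_0).
Y : (ℕ → ℕ) → ℕ → ℕ
Y c zero = 0
Y c (suc zero) = 1
Y c (suc (suc m)) = c m *ℕ Y c (suc m) +ℕ Y c m

Z : (ℕ → ℕ) → ℕ → ℕ
Z c zero = 1
Z c (suc zero) = 0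
Z c (suc (suc m)) = c m *ℕ Z c (suc m) +ℕ Z c m

y : (ℕ → ℕ) → ℕ → ℕ
y c k = Y c (suc k)

z : (ℕ → ℕ) → ℕ → ℕ
z c k = Z c (suc k)

-- κ_j and κ̃_j for j in block k (i.e. t_k < j ≤ t_{k+1}):
--   κ_j = y_{k-1} + (j - t_k) y_k,   κ̃_j = z_{k-1} + (j - t_k) z_k
kappa : (ℕ → ℕ) → ℕ → ℤ → ℤ
kappa c k j = + Y c k + (j - tk c k) * + y c k

kappaT : (ℕ → ℕ) → ℕ → ℤ → ℤ
kappaT c k j = + Z c k + (j - tk c k) * + z c k

-- floor (a / q) for q ≥ 1 (stdlib's ℤ division is Euclidean, which is the
-- floor for a positive divisor); junk value 0 for q = 0.
floorDiv : ℤ → ℕ → ℤ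
floorDiv a zero = + 0
floorDiv a (suc q) = a / (+ suc q)

{-# OPTIONS --safe #-}
module Submission where

-- Write y, z for the continuants of the convergents of p′/p = [c₀, …, cₙ] and
-- D m = p′ z_{m-1} - p y_{m-1}.  The signs of D alternate, and E m = |D m| are the
-- remainders of Euclid's algorithm on (p′, p): E (m+2) = E m - c_m E (m+1), they
-- decrease, are positive up to E (n+1), and E (n+2) = 0.  Best approximation: for
-- 0 < r < z_k and every q, |p′ r - p q| ≥ E k, because the coordinates of (r, q)
-- in the unimodular basis (z_{k-1}, y_{k-1}), (z_k, y_k) have opposite signs.  So
-- the residue ρ of p′ r modulo p satisfies E k ≤ ρ ≤ p - E k.  For j in block k′
-- the error p′ κ̃_j - p κ_j = ±(E k′ - m E (k′+1)), 1 ≤ m ≤ c_{k′}, is smaller than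
-- E k′ ≤ E k in absolute value; hence adding p′ κ̃_j = p κ_j + error to p′ r keeps
-- the residue inside [0, p) and raises the floor by exactly κ_j.

open import Defs
open import Data.Nat as ℕ using (ℕ; zero; suc; z≤n; s≤s)
  renaming (_≤_ to _≤ℕ_; _<_ to _<ℕ_; _*_ to _*ℕ_; _+_ to _+ℕ_)
import Data.Nat.Properties as ℕ
open import Data.Nat.Coprimality using (Coprime)
open import Data.Integer using (ℤ; +_; +[1+_]; 0ℤ; 1ℤ; -1ℤ; ∣_∣; _+_; _-_; -_; _*_; _<_; _≤_; _/_; _%_;
  +≤+; +<+; nonNegative) renaming (suc to sucℤ)
import Data.Integer.Properties as ℤ
import Data.Integer.DivMod as ℤ÷
import Data.Nat.Tactic.RingSolver as ℕ-Solver
import Data.Integer.Tactic.RingSolver as ℤ-Solver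
open import Data.Product using (_×_; _,_; proj₁; proj₂; ∃₂)
open import Data.Sum using (_⊎_; inj₁; inj₂)
open import Data.Empty using (⊥-elim)
open import Relation.Nullary using (yes; no)
open import Function using (_∘_)
open import Relation.Binary.PropositionalEquality

-- Continuants

cfFrom-suc : ∀ c i m →
  cfFrom c i (suc m) ≡ (c i *ℕ proj₁ (cfFrom c (suc i) m) +ℕ proj₂ (cfFrom c (suc i) m) , proj₁ (cfFrom c (suc i) m))
cfFrom-suc c i m with cfFrom c (suc i) m
... | a , b = refl

cfFrom-shift : ∀ c i m → cfFrom c (suc i) m ≡ cfFrom (c ∘ suc) i m
cfFrom-shift c i zero = refl
cfFrom-shift c i (suc m)
  rewrite cfFrom-suc c (suc i) m | cfFrom-suc (c ∘ suc) i m | cfFrom-shift c (suc i) m = refl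

Y-peel : ∀ c k → Y c (suc k) ≡ c 0 *ℕ Y (c ∘ suc) k +ℕ Z (c ∘ suc) k
Z-peel : ∀ c k → Z c (suc k) ≡ Y (c ∘ suc) k
Y-peel c zero = cong (_+ℕ 1) (sym (ℕ.*-zeroʳ (c 0)))
Y-peel c (suc zero) = refl
Y-peel c (suc (suc k)) =
  trans (cong₂ (λ u v → c (suc k) *ℕ u +ℕ v) (Y-peel c (suc k)) (Y-peel c k)) (regroup (c 0) (c (suc k)) _ _ _ _)
  where
  regroup : ∀ a b y₁ z₁ y₀ z₀ → b *ℕ (a *ℕ y₁ +ℕ z₁) +ℕ (a *ℕ y₀ +ℕ z₀) ≡ a *ℕ (b *ℕ y₁ +ℕ y₀) +ℕ (b *ℕ z₁ +ℕ z₀)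
  regroup = ℕ-Solver.solve-∀
Z-peel c zero = refl
Z-peel c (suc zero) = cong (_+ℕ 1) (ℕ.*-zeroʳ (c 0))
Z-peel c (suc (suc k)) rewrite Z-peel c (suc k) | Z-peel c k = refl

cfFrom-zero : ∀ c m → cfFrom c 0 m ≡ (Y c (2 +ℕ m) , Z c (2 +ℕ m))
cfFrom-zero c zero =
  cong₂ _,_ (sym (trans (ℕ.+-identityʳ _) (ℕ.*-identityʳ (c 0)))) (cong (_+ℕ 1) (sym (ℕ.*-zeroʳ (c 0))))
cfFrom-zero c (suc m)
  rewrite cfFrom-suc c 0 m | cfFrom-shift c 0 m | cfFrom-zero (c ∘ suc) m
        | Y-peel c (2 +ℕ m) | Z-peel c (2 +ℕ m) = refl

cfNum≡Y : ∀ c n → cfNum c n ≡ Y c (2 +ℕ n)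
cfNum≡Y c n with cfFrom c 0 n | cfFrom-zero c n
... | _ | refl = refl

cfDen≡Z : ∀ c n → cfDen c n ≡ Z c (2 +ℕ n)
cfDen≡Z c n with cfFrom c 0 n | cfFrom-zero c n
... | _ | refl = refl

alt : ℕ → ℤ
alt zero = 1ℤ
alt (suc m) = - alt m

alt*alt≡1 : ∀ m → alt m * alt m ≡ 1ℤ
alt*alt≡1 zero = refl
alt*alt≡1 (suc m) = trans (neg*neg (alt m)) (alt*alt≡1 m)
  where
  neg*neg : ∀ i → - i * - i ≡ i * i
  neg*neg = ℤ-Solver.solve-∀

∣alt∣≡1 : ∀ m → ∣ alt m ∣ ≡ 1
∣alt∣≡1 zero = refl
∣alt∣≡1 (suc m) = trans (ℤ.∣-i∣≡∣i∣ (alt m)) (∣alt∣≡1 m)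

∣alt*i∣≡∣i∣ : ∀ m i → ∣ alt m * i ∣ ≡ ∣ i ∣
∣alt*i∣≡∣i∣ m i = trans (ℤ.abs-* (alt m) i) (trans (cong (ℕ._* ∣ i ∣) (∣alt∣≡1 m)) (ℕ.*-identityˡ ∣ i ∣))

pos-*-+ : ∀ a b d → + (a *ℕ b +ℕ d) ≡ + a * + b + + d
pos-*-+ a b d = trans (ℤ.pos-+ (a *ℕ b) d) (cong (_+ + d) (ℤ.pos-* a b))

*-nonNeg : ∀ {a b} → 0ℤ ≤ a → 0ℤ ≤ b → 0ℤ ≤ a * b
*-nonNeg {a} {b} 0≤a 0≤b = ℤ.*-monoʳ-≤-nonNeg b {{nonNegative 0≤b}} 0≤a

*-nonPos : ∀ {a b} → a ≤ 0ℤ → 0ℤ ≤ b → a * b ≤ 0ℤ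
*-nonPos {a} {b} a≤0 0≤b = ℤ.*-monoʳ-≤-nonNeg b {{nonNegative 0≤b}} a≤0

i≤m*i : ∀ {i m} → 0ℤ ≤ i → 1ℤ ≤ m → i ≤ m * i
i≤m*i {i} {m} 0≤i 1≤m = subst (_≤ m * i) (ℤ.*-identityˡ i) (ℤ.*-monoʳ-≤-nonNeg i {{nonNegative 0≤i}} 1≤m)

i-j<i : ∀ i {j} → 0ℤ < j → i - j < i
i-j<i i 0<j = subst (i - _ <_) (ℤ.+-identityʳ i) (ℤ.+-monoʳ-< i (ℤ.neg-mono-< 0<j))

i-j+j≡i : ∀ i j → i - j + j ≡ i
i-j+j≡i = ℤ-Solver.solve-∀

-- Floor division

floor-bracket : ∀ {a r} q P → a ≡ r + q * P → 0ℤ ≤ r → r < P → q * P ≤ a × a < sucℤ q * P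
floor-bracket {a} {r} q P a≡ 0≤r r<P = lower , upper
  where
  open ℤ.≤-Reasoning
  lower : q * P ≤ a
  lower = begin
    q * P          ≤⟨ ℤ.i≤j+i (q * P) r {{nonNegative 0≤r}} ⟩
    r + q * P      ≡⟨ a≡ ⟨
    a              ∎
  upper : a < sucℤ q * P
  upper = begin-strict
    a              ≡⟨ a≡ ⟩
    r + q * P      <⟨ ℤ.+-monoˡ-< (q * P) r<P ⟩
    P + q * P      ≡⟨ ℤ.suc-* q P ⟨
    sucℤ q * P     ∎

floor-bracket-≤ : ∀ {a} q q′ P → 0ℤ ≤ P → q * P ≤ a → a < sucℤ q′ * P → q ≤ q′
floor-bracket-≤ q q′ P 0≤P qP≤a a<q′P = ℤ.≤-trans (ℤ.i<j⇒i≤pred[j] q<q′+1) (ℤ.≤-reflexive (ℤ.pred-suc q′))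
  where
  q<q′+1 : q < sucℤ q′
  q<q′+1 = ℤ.*-cancelʳ-<-nonNeg P {{nonNegative 0≤P}} (ℤ.≤-<-trans qP≤a a<q′P)

/-unique : ∀ d {a q r} → a ≡ r + q * +[1+ d ] → 0ℤ ≤ r → r < +[1+ d ] → a / +[1+ d ] ≡ q
/-unique d {a} {q} a≡ 0≤r r<P = ℤ.≤-antisym (floor-bracket-≤ (a / P) q P 0≤P (proj₁ floor) (proj₂ given))
                                             (floor-bracket-≤ q (a / P) P 0≤P (proj₁ given) (proj₂ floor))
  where
  P : ℤ
  P = +[1+ d ]
  0≤P : 0ℤ ≤ P
  0≤P = +≤+ z≤n
  given : q * P ≤ a × a < sucℤ q * P
  given = floor-bracket q P a≡ 0≤r r<P
  floor : a / P * P ≤ a × a < sucℤ (a / P) * P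
  floor = floor-bracket (a / P) P (ℤ÷.a≡a%n+[a/n]*n a P) (+≤+ z≤n) (+<+ (ℤ÷.n%d<d a P))

floor-shift : ∀ d a r κ̃ κ →
  let P = +[1+ d ]; x = a * κ̃ - P * κ in
  0ℤ ≤ + ((a * r) % P) + x → + ((a * r) % P) + x < P → (a * (r + κ̃)) / P ≡ (a * r) / P + κ
floor-shift d a r κ̃ κ 0≤ρ+x ρ+x<P = /-unique d split 0≤ρ+x ρ+x<P
  where
  open ≡-Reasoning
  P ρ q : ℤ
  P = +[1+ d ]
  ρ = + ((a * r) % P)
  q = (a * r) / P
  regroup : ∀ ρ q P a κ̃ κ → ρ + q * P + a * κ̃ ≡ ρ + (a * κ̃ - P * κ) + (q + κ) * P
  regroup = ℤ-Solver.solve-∀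
  split : a * (r + κ̃) ≡ ρ + (a * κ̃ - P * κ) + (q + κ) * P
  split = begin
    a * (r + κ̃)          ≡⟨ ℤ.*-distribˡ-+ a r κ̃ ⟩
    a * r + a * κ̃        ≡⟨ cong (_+ a * κ̃) (ℤ÷.a≡a%n+[a/n]*n (a * r) P) ⟩
    ρ + q * P + a * κ̃    ≡⟨ regroup ρ q P a κ̃ κ ⟩
    ρ + (a * κ̃ - P * κ) + (q + κ) * P ∎

residue-far-from-ends : ∀ d a {e} → (∀ q → e ≤ + ∣ a - +[1+ d ] * q ∣) →
                        e ≤ + (a % +[1+ d ]) × + (a % +[1+ d ]) + e ≤ +[1+ d ]
residue-far-from-ends d a {e} far = subst (e ≤_) (cong (+_ ∘ ∣_∣) a-Pq≡ρ) (far (a / P)) , ρ+e≤P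
  where
  P ρ : ℤ
  P = +[1+ d ]
  ρ = + (a % P)
  a≡ : a ≡ ρ + a / P * P
  a≡ = ℤ÷.a≡a%n+[a/n]*n a P
  cancel₀ : ∀ ρ q P → ρ + q * P - P * q ≡ ρ
  cancel₀ = ℤ-Solver.solve-∀
  cancel₁ : ∀ ρ q P → ρ + q * P - P * (q + 1ℤ) ≡ ρ - P
  cancel₁ = ℤ-Solver.solve-∀
  cancel₂ : ∀ ρ P → ρ + (P - ρ) ≡ P
  cancel₂ = ℤ-Solver.solve-∀
  a-Pq≡ρ : a - P * (a / P) ≡ ρ
  a-Pq≡ρ = trans (cong (_- P * (a / P)) a≡) (cancel₀ ρ (a / P) P)
  a-P[q+1]≡ρ-P : a - P * (a / P + 1ℤ) ≡ ρ - P
  a-P[q+1]≡ρ-P = trans (cong (_- P * (a / P + 1ℤ)) a≡) (cancel₁ ρ (a / P) P)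
  e≤P-ρ : e ≤ P - ρ
  e≤P-ρ = subst (e ≤_) (trans (cong (+_ ∘ ∣_∣) a-P[q+1]≡ρ-P) (ℤ.∣-∣-≤ (ℤ.<⇒≤ (+<+ (ℤ÷.n%d<d a P)))))
                (far (a / P + 1ℤ))
  ρ+e≤P : ρ + e ≤ P
  ρ+e≤P = ℤ.≤-trans (ℤ.+-monoʳ-≤ ρ e≤P-ρ) (ℤ.≤-reflexive (cancel₂ ρ P))

+-within : ∀ {e ρ P w} → e ≤ ρ → ρ + e ≤ P → 0ℤ ≤ w → w < e → 0ℤ ≤ ρ + w × ρ + w < P
+-within {e} {ρ} e≤ρ ρ+e≤P 0≤w w<e =
  ℤ.+-mono-≤ (ℤ.≤-trans (ℤ.≤-trans 0≤w (ℤ.<⇒≤ w<e)) e≤ρ) 0≤w , ℤ.<-≤-trans (ℤ.+-monoʳ-< ρ w<e) ρ+e≤P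

-‿within : ∀ {e ρ P w} → e ≤ ρ → ρ + e ≤ P → 0ℤ ≤ w → w < e → 0ℤ ≤ ρ - w × ρ - w < P
-‿within {e} {ρ} {P} {w} e≤ρ ρ+e≤P 0≤w w<e = 0≤ρ-w , ρ-w<P
  where
  open ℤ.≤-Reasoning
  0≤ρ-w : 0ℤ ≤ ρ - w
  0≤ρ-w = begin
    0ℤ       ≤⟨ ℤ.i≤j⇒0≤j-i e≤ρ ⟩
    ρ - e    ≤⟨ ℤ.+-monoʳ-≤ ρ (ℤ.neg-mono-≤ (ℤ.<⇒≤ w<e)) ⟩
    ρ - w    ∎
  ρ-w<P : ρ - w < P
  ρ-w<P = begin-strict
    ρ - w    ≤⟨ ℤ.i-j≤i ρ w {{nonNegative 0≤w}} ⟩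
    ρ        ≡⟨ ℤ.+-identityʳ ρ ⟨
    ρ + 0ℤ   <⟨ ℤ.+-monoʳ-< ρ (ℤ.≤-<-trans 0≤w w<e) ⟩
    ρ + e    ≤⟨ ρ+e≤P ⟩
    P        ∎

shift-within : ∀ {e ρ P} x → e ≤ ρ → ρ + e ≤ P → + ∣ x ∣ < e → 0ℤ ≤ ρ + x × ρ + x < P
shift-within {ρ = ρ} {P} x e≤ρ ρ+e≤P ∣x∣<e with ℤ.+∣i∣≡i⊎+∣i∣≡-i x
... | inj₁ ∣x∣≡x  = subst (λ y → 0ℤ ≤ ρ + y × ρ + y < P) ∣x∣≡x (+-within e≤ρ ρ+e≤P (+≤+ z≤n) ∣x∣<e)
... | inj₂ ∣x∣≡-x = subst (λ y → 0ℤ ≤ ρ + y × ρ + y < P) (trans (cong -_ ∣x∣≡-x) (ℤ.neg-involutive x))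
                          (-‿within e≤ρ ρ+e≤P (+≤+ z≤n) ∣x∣<e)

-- Lattice coordinates

unimodular-coordinates : ∀ {s} y₀ y₁ z₀ z₁ → y₁ * z₀ - y₀ * z₁ ≡ s → s * s ≡ 1ℤ →
  ∀ u v → ∃₂ λ a b → u ≡ a * z₀ + b * z₁ × v ≡ a * y₀ + b * y₁
unimodular-coordinates {s} y₀ y₁ z₀ z₁ det s²≡1 u v =
  a , b , sym (trans (expand-z s u v y₀ y₁ z₀ z₁) (cancel u)) , sym (trans (expand-y s u v y₀ y₁ z₀ z₁) (cancel v))
  where
  a b : ℤ
  a = s * (u * y₁ - v * z₁)
  b = s * (v * z₀ - u * y₀)
  expand-z : ∀ s u v y₀ y₁ z₀ z₁ →
    s * (u * y₁ - v * z₁) * z₀ + s * (v * z₀ - u * y₀) * z₁ ≡ s * (y₁ * z₀ - y₀ * z₁) * u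
  expand-z = ℤ-Solver.solve-∀
  expand-y : ∀ s u v y₀ y₁ z₀ z₁ →
    s * (u * y₁ - v * z₁) * y₀ + s * (v * z₀ - u * y₀) * y₁ ≡ s * (y₁ * z₀ - y₀ * z₁) * v
  expand-y = ℤ-Solver.solve-∀
  cancel : ∀ t → s * (y₁ * z₀ - y₀ * z₁) * t ≡ t
  cancel t = trans (cong (λ x → s * x * t) det) (trans (cong (_* t) s²≡1) (ℤ.*-identityˡ t))

opposite-signs : ∀ {r z₀ z₁ : ℕ} a b → 0 <ℕ r → r <ℕ z₁ → + r ≡ a * + z₀ + b * + z₁ →
                 (0ℤ < a × b ≤ 0ℤ) ⊎ (a < 0ℤ × 0ℤ ≤ b)
opposite-signs {r} {z₀} {z₁} a b 0<r r<z₁ r≡ with 0ℤ ℤ.<? b | a ℤ.<? 0ℤ | 0ℤ ℤ.<? a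
... | yes 0<b | yes a<0 | _ = inj₂ (a<0 , ℤ.<⇒≤ 0<b)
... | yes 0<b | no a≮0  | _ = ⊥-elim (ℕ.<⇒≱ r<z₁ (ℤ.drop‿+≤+ z₁≤r))
  where
  open ℤ.≤-Reasoning
  z₁≤r : + z₁ ≤ + r
  z₁≤r = begin
    + z₁                   ≤⟨ i≤m*i (+≤+ z≤n) (ℤ.i<j⇒suc[i]≤j 0<b) ⟩
    b * + z₁               ≤⟨ ℤ.i≤j+i _ (a * + z₀) {{nonNegative (*-nonNeg (ℤ.≮⇒≥ a≮0) (+≤+ z≤n))}} ⟩
    a * + z₀ + b * + z₁    ≡⟨ r≡ ⟨
    + r                    ∎
... | no b≯0 | _ | yes 0<a = inj₁ (0<a , ℤ.≮⇒≥ b≯0)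
... | no b≯0 | _ | no a≯0  = ⊥-elim (ℕ.<⇒≱ 0<r (ℤ.drop‿+≤+ r≤0))
  where
  open ℤ.≤-Reasoning
  r≤0 : + r ≤ 0ℤ
  r≤0 = begin
    + r                    ≡⟨ r≡ ⟩
    a * + z₀ + b * + z₁    ≤⟨ ℤ.+-mono-≤ (*-nonPos (ℤ.≮⇒≥ a≯0) (+≤+ z≤n)) (*-nonPos (ℤ.≮⇒≥ b≯0) (+≤+ z≤n)) ⟩
    0ℤ                     ∎

e≤a*e-b*e′ : ∀ {a b e e′} → 0ℤ < a → b ≤ 0ℤ → 0ℤ ≤ e → 0ℤ ≤ e′ → e ≤ a * e - b * e′
e≤a*e-b*e′ {a} {b} {e} {e′} 0<a b≤0 0≤e 0≤e′ = begin
  e                   ≤⟨ i≤m*i 0≤e (ℤ.i<j⇒suc[i]≤j 0<a) ⟩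
  a * e               ≤⟨ ℤ.i≤i+j (a * e) (- (b * e′)) {{nonNegative (ℤ.neg-mono-≤ (*-nonPos b≤0 0≤e′))}} ⟩
  a * e - b * e′      ∎
  where open ℤ.≤-Reasoning

e≤∣a*e-b*e′∣ : ∀ {a b e e′} → 0ℤ ≤ e → 0ℤ ≤ e′ → (0ℤ < a × b ≤ 0ℤ) ⊎ (a < 0ℤ × 0ℤ ≤ b) →
               e ≤ + ∣ a * e - b * e′ ∣
e≤∣a*e-b*e′∣ {a} {b} {e} {e′} 0≤e 0≤e′ (inj₁ (0<a , b≤0)) =
  subst (e ≤_) (sym (ℤ.0≤i⇒+∣i∣≡i (ℤ.≤-trans 0≤e e≤x))) e≤x
  where
  e≤x : e ≤ a * e - b * e′
  e≤x = e≤a*e-b*e′ 0<a b≤0 0≤e 0≤e′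
e≤∣a*e-b*e′∣ {a} {b} {e} {e′} 0≤e 0≤e′ (inj₂ (a<0 , 0≤b)) =
  subst (λ x → e ≤ + x) ∣-x∣≡∣x∣ (e≤∣a*e-b*e′∣ 0≤e 0≤e′ (inj₁ (ℤ.neg-mono-< a<0 , ℤ.neg-mono-≤ 0≤b)))
  where
  negate : ∀ a b e e′ → - a * e - - b * e′ ≡ - (a * e - b * e′)
  negate = ℤ-Solver.solve-∀
  ∣-x∣≡∣x∣ : ∣ - a * e - - b * e′ ∣ ≡ ∣ a * e - b * e′ ∣
  ∣-x∣≡∣x∣ = trans (cong ∣_∣ (negate a b e e′)) (ℤ.∣-i∣≡∣i∣ (a * e - b * e′))

-- Euclidean remainders

module Descent (c : ℕ → ℕ) (n : ℕ) (c-pos : ∀ m → m ≤ℕ n → 1 ≤ℕ c m)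
               (E : ℕ → ℤ) (E-rec : ∀ m → E (2 +ℕ m) ≡ E m - + c m * E (suc m))
               (E-last : E (2 +ℕ n) ≡ 0ℤ) where

  E-step : ∀ {m} → m ≤ℕ n → 0ℤ ≤ E (2 +ℕ m) → 0ℤ ≤ E (suc m) → E (suc m) ≤ E m
  E-step {m} m≤n 0≤E″ 0≤E′ = begin
    E (suc m)                                     ≤⟨ i≤m*i 0≤E′ (+≤+ (c-pos m m≤n)) ⟩
    + c m * E (suc m)                             ≤⟨ ℤ.i≤j+i _ (E (2 +ℕ m)) {{nonNegative 0≤E″}} ⟩
    E (2 +ℕ m) + + c m * E (suc m)                ≡⟨ cong (_+ + c m * E (suc m)) (E-rec m) ⟩
    E m - + c m * E (suc m) + + c m * E (suc m)   ≡⟨ i-j+j≡i (E m) (+ c m * E (suc m)) ⟩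
    E m                                           ∎
    where open ℤ.≤-Reasoning

  Descending : ℕ → Set
  Descending m = E (suc n) ≤ E m × 0ℤ ≤ E (suc m) × E (suc m) ≤ E m

  descending : 0ℤ ≤ E (suc n) → ∀ {m} → m ≤ℕ suc n → Descending m
  descending 0≤g {m} m≤1+n = from-distance (suc n ℕ.∸ m) (ℕ.m∸n+n≡m m≤1+n)
    where
    from-distance : ∀ d {m} → d +ℕ m ≡ suc n → Descending m
    from-distance zero refl = ℤ.≤-refl , ℤ.≤-reflexive (sym E-last) , subst (_≤ E (suc n)) (sym E-last) 0≤g
    from-distance (suc d) {m} d+m≡n with from-distance d (trans (ℕ.+-suc d m) d+m≡n)
    ... | g≤E′ , 0≤E″ , _ = ℤ.≤-trans g≤E′ E′≤E , 0≤E′ , E′≤E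
      where
      0≤E′ : 0ℤ ≤ E (suc m)
      0≤E′ = ℤ.≤-trans 0≤g g≤E′
      E′≤E : E (suc m) ≤ E m
      E′≤E = E-step (subst (m ≤ℕ_) (ℕ.suc-injective d+m≡n) (ℕ.m≤n+m m d)) 0≤E″ 0≤E′

module Convergents (c : ℕ → ℕ) where

  Yℤ Zℤ : ℕ → ℤ
  Yℤ m = + Y c m
  Zℤ m = + Z c m

  determinant : ∀ m → Yℤ (suc m) * Zℤ m - Yℤ m * Zℤ (suc m) ≡ alt m
  determinant zero = refl
  determinant (suc m) = begin
    Yℤ (2 +ℕ m) * Zℤ (suc m) - Yℤ (suc m) * Zℤ (2 +ℕ m)
      ≡⟨ cong₂ (λ u v → u * Zℤ (suc m) - Yℤ (suc m) * v) (pos-*-+ (c m) _ _) (pos-*-+ (c m) _ _) ⟩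
    (+ c m * Yℤ (suc m) + Yℤ m) * Zℤ (suc m) - Yℤ (suc m) * (+ c m * Zℤ (suc m) + Zℤ m)
      ≡⟨ expand (+ c m) (Yℤ (suc m)) (Yℤ m) (Zℤ (suc m)) (Zℤ m) ⟩
    - (Yℤ (suc m) * Zℤ m - Yℤ m * Zℤ (suc m))
      ≡⟨ cong -_ (determinant m) ⟩
    alt (suc m) ∎
    where
    open ≡-Reasoning
    expand : ∀ a y₁ y₀ z₁ z₀ → (a * y₁ + y₀) * z₁ - y₁ * (a * z₁ + z₀) ≡ - (y₁ * z₀ - y₀ * z₁)
    expand = ℤ-Solver.solve-∀

  module Remainders (p p′ : ℕ) where

    D E : ℕ → ℤ
    D m = + p′ * Zℤ m - + p * Yℤ m
    E m = alt m * D m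

    D-rec : ∀ m → D (2 +ℕ m) ≡ + c m * D (suc m) + D m
    D-rec m = begin
      + p′ * Zℤ (2 +ℕ m) - + p * Yℤ (2 +ℕ m)
        ≡⟨ cong₂ (λ u v → + p′ * u - + p * v) (pos-*-+ (c m) _ _) (pos-*-+ (c m) _ _) ⟩
      + p′ * (+ c m * Zℤ (suc m) + Zℤ m) - + p * (+ c m * Yℤ (suc m) + Yℤ m)
        ≡⟨ regroup (+ p′) (+ p) (+ c m) (Yℤ (suc m)) (Yℤ m) (Zℤ (suc m)) (Zℤ m) ⟩
      + c m * D (suc m) + D m ∎
      where
      open ≡-Reasoning
      regroup : ∀ P′ P b y₁ y₀ z₁ z₀ →
        P′ * (b * z₁ + z₀) - P * (b * y₁ + y₀) ≡ b * (P′ * z₁ - P * y₁) + (P′ * z₀ - P * y₀)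
      regroup = ℤ-Solver.solve-∀

    E-rec : ∀ m → E (2 +ℕ m) ≡ E m - + c m * E (suc m)
    E-rec m = begin
      - - alt m * D (2 +ℕ m)                        ≡⟨ cong₂ _*_ (ℤ.neg-involutive (alt m)) (D-rec m) ⟩
      alt m * (+ c m * D (suc m) + D m)             ≡⟨ regroup (alt m) (+ c m) (D (suc m)) (D m) ⟩
      alt m * D m - + c m * (- alt m * D (suc m))   ∎
      where
      open ≡-Reasoning
      regroup : ∀ s b d₁ d₀ → s * (b * d₁ + d₀) ≡ s * d₀ - b * (- s * d₁)
      regroup = ℤ-Solver.solve-∀

    E-one : E 1 ≡ + p
    E-one = evaluate (+ p′) (+ p)
      where
      evaluate : ∀ a b → - 1ℤ * (a * 0ℤ - b * 1ℤ) ≡ b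
      evaluate = ℤ-Solver.solve-∀

    D≡alt*E : ∀ m → D m ≡ alt m * E m
    D≡alt*E m = sym (begin
      alt m * (alt m * D m)   ≡⟨ ℤ.*-assoc (alt m) (alt m) (D m) ⟨
      alt m * alt m * D m     ≡⟨ cong (_* D m) (alt*alt≡1 m) ⟩
      1ℤ * D m                ≡⟨ ℤ.*-identityˡ (D m) ⟩
      D m                     ∎)
      where open ≡-Reasoning

    E-vanishes : ∀ n → p′ *ℕ cfDen c n ≡ cfNum c n *ℕ p → E (2 +ℕ n) ≡ 0ℤ
    E-vanishes n cf≡ = begin
      alt m * (+ p′ * Zℤ m - + p * Yℤ m)   ≡⟨ cong (λ u → alt m * (u - + p * Yℤ m)) p′Z≡pY ⟩
      alt m * (+ p * Yℤ m - + p * Yℤ m)    ≡⟨ cong (alt m *_) (ℤ.+-inverseʳ (+ p * Yℤ m)) ⟩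
      alt m * 0ℤ                           ≡⟨ ℤ.*-zeroʳ (alt m) ⟩
      0ℤ                                   ∎
      where
      open ≡-Reasoning
      m : ℕ
      m = 2 +ℕ n
      p′Z≡pY : + p′ * Zℤ m ≡ + p * Yℤ m
      p′Z≡pY = begin
        + p′ * + Z c m    ≡⟨ ℤ.pos-* p′ (Z c m) ⟨
        + (p′ *ℕ Z c m)   ≡⟨ cong +_ (subst₂ (λ u v → p′ *ℕ u ≡ p *ℕ v) (cfDen≡Z c n) (cfNum≡Y c n)
                                             (trans cf≡ (ℕ.*-comm _ p))) ⟩
        + (p *ℕ Y c m)    ≡⟨ ℤ.pos-* p (Y c m) ⟩
        + p * + Y c m     ∎

    intermediate-error : ∀ k m →
      + p′ * (Zℤ k + m * Zℤ (suc k)) - + p * (Yℤ k + m * Yℤ (suc k)) ≡ alt k * (E k - m * E (suc k))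
    intermediate-error k m = begin
      + p′ * (Zℤ k + m * Zℤ (suc k)) - + p * (Yℤ k + m * Yℤ (suc k))
        ≡⟨ regroup (+ p′) (+ p) m (Yℤ k) (Yℤ (suc k)) (Zℤ k) (Zℤ (suc k)) ⟩
      D k + m * D (suc k)
        ≡⟨ cong₂ (λ u v → u + m * v) (D≡alt*E k) (D≡alt*E (suc k)) ⟩
      alt k * E k + m * (- alt k * E (suc k))
        ≡⟨ factor m (alt k) (E k) (E (suc k)) ⟩
      alt k * (E k - m * E (suc k)) ∎
      where
      open ≡-Reasoning
      regroup : ∀ P′ P m y₀ y₁ z₀ z₁ →
        P′ * (z₀ + m * z₁) - P * (y₀ + m * y₁) ≡ (P′ * z₀ - P * y₀) + m * (P′ * z₁ - P * y₁)
      regroup = ℤ-Solver.solve-∀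
      factor : ∀ m s e e′ → s * e + m * (- s * e′) ≡ s * (e - m * e′)
      factor = ℤ-Solver.solve-∀

    module Expansion (n : ℕ) (c-pos : ∀ m → m ≤ℕ n → 1 ≤ℕ c m)
                     (cf≡ : p′ *ℕ cfDen c n ≡ cfNum c n *ℕ p) (0<p : 0 <ℕ p) where

      open Descent c n c-pos E E-rec (E-vanishes n cf≡)

      -- The recursion is linear, so - E satisfies it too; descending applied to - E
      -- rules out E (n+1) ≤ 0 since E 1 = p > 0.
      E-last-pos : 0ℤ < E (suc n)
      E-last-pos with 0ℤ ℤ.<? E (suc n)
      ... | yes 0<g = 0<g
      ... | no g≯0 = ⊥-elim (ℤ.<⇒≱ (subst (0ℤ <_) (sym E-one) (+<+ 0<p)) (ℤ.≤-trans E₁≤g (ℤ.≮⇒≥ g≯0)))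
        where
        negate : ∀ x b y → - (x - b * y) ≡ - x - b * - y
        negate = ℤ-Solver.solve-∀
        -E-rec : ∀ m → - E (2 +ℕ m) ≡ - E m - + c m * - E (suc m)
        -E-rec m = trans (cong -_ (E-rec m)) (negate (E m) (+ c m) (E (suc m)))
        E₁≤g : E 1 ≤ E (suc n)
        E₁≤g = ℤ.neg-cancel-≤ (proj₁ (Descent.descending c n c-pos (-_ ∘ E) -E-rec (cong -_ (E-vanishes n cf≡))
                                        (ℤ.neg-mono-≤ (ℤ.≮⇒≥ g≯0)) (s≤s z≤n)))

      E-pos : ∀ {m} → m ≤ℕ suc n → 0ℤ < E m
      E-pos m≤1+n = ℤ.<-≤-trans E-last-pos (proj₁ (descending (ℤ.<⇒≤ E-last-pos) m≤1+n))

      E-nonneg : ∀ {m} → m ≤ℕ 2 +ℕ n → 0ℤ ≤ E m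
      E-nonneg {zero} _ = ℤ.<⇒≤ (E-pos z≤n)
      E-nonneg {suc m} (s≤s m≤1+n) = proj₁ (proj₂ (descending (ℤ.<⇒≤ E-last-pos) m≤1+n))

      E-antitone : ∀ {k k′} → k ≤ℕ k′ → k′ ≤ℕ suc n → E k′ ≤ E k
      E-antitone k≤k′ = go (ℕ.≤⇒≤′ k≤k′)
        where
        go : ∀ {k k′} → k ℕ.≤′ k′ → k′ ≤ℕ suc n → E k′ ≤ E k
        go ℕ.≤′-refl _ = ℤ.≤-refl
        go (ℕ.≤′-step k≤′k′) k′<1+n =
          ℤ.≤-trans (proj₂ (proj₂ (descending (ℤ.<⇒≤ E-last-pos) (ℕ.<⇒≤ k′<1+n)))) (go k≤′k′ (ℕ.<⇒≤ k′<1+n))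

      best-approximation : ∀ {k r} → k ≤ℕ n → 0 <ℕ r → r <ℕ Z c (suc k) → ∀ q → E k ≤ + ∣ + p′ * + r - + p * q ∣
      best-approximation {k} {r} k≤n 0<r r<z q
        with unimodular-coordinates (Yℤ k) (Yℤ (suc k)) (Zℤ k) (Zℤ (suc k)) (determinant k) (alt*alt≡1 k) (+ r) q
      ... | a , b , r≡ , q≡ = subst (λ x → E k ≤ + x) ∣a*E-b*E′∣≡∣V∣
          (e≤∣a*e-b*e′∣ (E-nonneg (ℕ.≤-trans k≤n (ℕ.m≤n+m n 2))) (E-nonneg (s≤s (ℕ.m≤n⇒m≤1+n k≤n)))
                         (opposite-signs a b 0<r r<z r≡))
        where
        open ≡-Reasoning
        regroup : ∀ P′ P a b y₀ y₁ z₀ z₁ →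
          P′ * (a * z₀ + b * z₁) - P * (a * y₀ + b * y₁) ≡ a * (P′ * z₀ - P * y₀) + b * (P′ * z₁ - P * y₁)
        regroup = ℤ-Solver.solve-∀
        factor : ∀ a b s e e′ → a * (s * e) + b * (- s * e′) ≡ s * (a * e - b * e′)
        factor = ℤ-Solver.solve-∀
        V≡ : + p′ * + r - + p * q ≡ alt k * (a * E k - b * E (suc k))
        V≡ = begin
          + p′ * + r - + p * q
            ≡⟨ cong₂ (λ u v → + p′ * u - + p * v) r≡ q≡ ⟩
          + p′ * (a * Zℤ k + b * Zℤ (suc k)) - + p * (a * Yℤ k + b * Yℤ (suc k))
            ≡⟨ regroup (+ p′) (+ p) a b (Yℤ k) (Yℤ (suc k)) (Zℤ k) (Zℤ (suc k)) ⟩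
          a * D k + b * D (suc k)
            ≡⟨ cong₂ (λ u v → a * u + b * v) (D≡alt*E k) (D≡alt*E (suc k)) ⟩
          a * (alt k * E k) + b * (- alt k * E (suc k))
            ≡⟨ factor a b (alt k) (E k) (E (suc k)) ⟩
          alt k * (a * E k - b * E (suc k)) ∎
        ∣a*E-b*E′∣≡∣V∣ : ∣ a * E k - b * E (suc k) ∣ ≡ ∣ + p′ * + r - + p * q ∣
        ∣a*E-b*E′∣≡∣V∣ = trans (sym (∣alt*i∣≡∣i∣ k _)) (cong ∣_∣ (sym V≡))

      ∣intermediate-error∣<E : ∀ {k k′} m → k ≤ℕ k′ → k′ ≤ℕ n → 1ℤ ≤ m → m ≤ + c k′ →
        + ∣ + p′ * (Zℤ k′ + m * Zℤ (suc k′)) - + p * (Yℤ k′ + m * Yℤ (suc k′)) ∣ < E k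
      ∣intermediate-error∣<E {k} {k′} m k≤k′ k′≤n 1≤m m≤c =
        subst (_< E k) (sym ∣X∣≡w) (ℤ.<-≤-trans (i-j<i (E k′) 0<mE′) (E-antitone k≤k′ (ℕ.m≤n⇒m≤1+n k′≤n)))
        where
        open ℤ.≤-Reasoning
        regroup : ∀ x b m y → x - b * y + (b - m) * y ≡ x - m * y
        regroup = ℤ-Solver.solve-∀
        0≤w : 0ℤ ≤ E k′ - m * E (suc k′)
        0≤w = begin
          0ℤ
            ≤⟨ ℤ.+-mono-≤ (E-nonneg (s≤s (s≤s k′≤n)))
                          (*-nonNeg (ℤ.i≤j⇒0≤j-i m≤c) (E-nonneg (s≤s (ℕ.m≤n⇒m≤1+n k′≤n)))) ⟩
          E (2 +ℕ k′) + (+ c k′ - m) * E (suc k′)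
            ≡⟨ cong (_+ (+ c k′ - m) * E (suc k′)) (E-rec k′) ⟩
          E k′ - + c k′ * E (suc k′) + (+ c k′ - m) * E (suc k′)
            ≡⟨ regroup (E k′) (+ c k′) m (E (suc k′)) ⟩
          E k′ - m * E (suc k′) ∎
        ∣X∣≡w : + ∣ + p′ * (Zℤ k′ + m * Zℤ (suc k′)) - + p * (Yℤ k′ + m * Yℤ (suc k′)) ∣ ≡ E k′ - m * E (suc k′)
        ∣X∣≡w = trans (cong (+_ ∘ ∣_∣) (intermediate-error k′ m))
                      (trans (cong +_ (∣alt*i∣≡∣i∣ k′ _)) (ℤ.0≤i⇒+∣i∣≡i 0≤w))
        0<mE′ : 0ℤ < m * E (suc k′)
        0<mE′ = ℤ.<-≤-trans (E-pos (s≤s k′≤n)) (i≤m*i (ℤ.<⇒≤ (E-pos (s≤s k′≤n))) 1≤m)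

-- Blocks of indices

S-mono : ∀ c {a b} → a ≤ℕ b → S c a ≤ℕ S c b
S-mono c a≤b = go (ℕ.≤⇒≤′ a≤b)
  where
  go : ∀ {a b} → a ℕ.≤′ b → S c a ≤ℕ S c b
  go ℕ.≤′-refl = ℕ.≤-refl
  go (ℕ.≤′-step a≤′b) = ℕ.≤-trans (go a≤′b) (ℕ.m≤m+n _ _)

tk-cancel-< : ∀ c {a b} → tk c a < tk c b → a <ℕ b
tk-cancel-< c tₐ<t_b = ℕ.≰⇒> (λ b≤a → ℤ.<⇒≱ tₐ<t_b (ℤ.+-monoˡ-≤ -1ℤ (+≤+ (S-mono c b≤a))))

block-offset : ∀ c k {j} → tk c k < j → j ≤ tk c (suc k) → 1ℤ ≤ j - tk c k × j - tk c k ≤ + c k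
block-offset c k {j} t<j j≤t′ =
  subst (_≤ j - t) (cancel₁ t) (ℤ.+-monoˡ-≤ (- t) (ℤ.i<j⇒suc[i]≤j t<j)) ,
  subst (j - t ≤_) (cancel₂ (+ S c k) (+ c k))
        (ℤ.+-monoˡ-≤ (- t) (subst (j ≤_) (cong (_- 1ℤ) (ℤ.pos-+ (S c k) (c k))) j≤t′))
  where
  t : ℤ
  t = tk c k
  cancel₁ : ∀ t → 1ℤ + t - t ≡ 1ℤ
  cancel₁ = ℤ-Solver.solve-∀
  cancel₂ : ∀ s b → s + b - 1ℤ - (s - 1ℤ) ≡ b
  cancel₂ = ℤ-Solver.solve-∀

partial-quotients-pos : ∀ (c : ℕ → ℕ) {n} → (∀ i → i <ℕ n → 1 ≤ℕ c i) → 2 ≤ℕ c n → ∀ i → i ≤ℕ n → 1 ≤ℕ c i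
partial-quotients-pos c c<n 2≤cₙ i i≤n with ℕ.m≤n⇒m<n∨m≡n i≤n
... | inj₁ i<n = c<n i i<n
... | inj₂ refl = ℕ.<⇒≤ 2≤cₙ

lemmaE6 : (p p' : ℕ) → Coprime p p' → 1 ≤ℕ p → p <ℕ p' →
          (n : ℕ) (c : ℕ → ℕ) →
          (∀ i → i <ℕ n → 1 ≤ℕ c i) → 2 ≤ℕ c n →
          p' *ℕ cfDen c n ≡ cfNum c n *ℕ p →
          (k : ℕ) → 1 <ℕ k → k ≤ℕ n →
          (r : ℕ) → 1 ≤ℕ r → r <ℕ z c k →
          (j : ℤ) → tk c k < j → j ≤ tt c n →
          (k' : ℕ) → k' ≤ℕ n → tk c k' < j → j ≤ tk c (suc k') →
          floorDiv (+ p' * (+ r + kappaT c k' j)) p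
            ≡ floorDiv (+ p' * + r) p + kappa c k' j
lemmaE6 (suc p₀) p′ _ _ _ n c c<n 2≤cₙ cf≡ k _ k≤n r 0<r r<zₖ j tₖ<j _ k′ k′≤n tₖ′<j j≤tₖ′₊₁ =
  floor-shift p₀ (+ p′) (+ r) (kappaT c k′ j) (kappa c k′ j) (proj₁ within) (proj₂ within)
  where
  open Convergents c
  open Remainders (suc p₀) p′
  open Expansion n (partial-quotients-pos c c<n 2≤cₙ) cf≡ (s≤s z≤n)
  P ρ X : ℤ
  P = +[1+ p₀ ]
  ρ = + ((+ p′ * + r) % P)
  X = + p′ * kappaT c k′ j - P * kappa c k′ j
  residue : E k ≤ ρ × ρ + E k ≤ P
  residue = residue-far-from-ends p₀ (+ p′ * + r) (best-approximation k≤n 0<r r<zₖ)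
  offset : 1ℤ ≤ j - tk c k′ × j - tk c k′ ≤ + c k′
  offset = block-offset c k′ tₖ′<j j≤tₖ′₊₁
  k≤k′ : k ≤ℕ k′
  k≤k′ = ℕ.s≤s⁻¹ (tk-cancel-< c (ℤ.<-≤-trans tₖ<j j≤tₖ′₊₁))
  within : 0ℤ ≤ ρ + X × ρ + X < P
  within = shift-within X (proj₁ residue) (proj₂ residue)
                        (∣intermediate-error∣<E (j - tk c k′) k≤k′ k′≤n (proj₁ offset) (proj₂ offset))
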